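{- Let $m \le n$ be integers with $m$ even, and let $c \in \mathcal{S}_n$ be an $m$-cycle. There is a bijection between the non-trivial cycles of $c^{m/2}$ (i.e. the sets $\{x, c^{m/2}(x)\}$ with $x$ in the support of $c$) and the decompositions $c = \sigma\tau$ in which $\sigma \in \mathcal{S}_n$ is a product of $\frac{m}{2}$ disjoint transpositions and $\tau \in \mathcal{S}_n$ is a product of $\frac{m}{2}-1$ disjoint transpositions. Consequently there are exactly $\frac{m}{2}$ such decompositions of $c$.
   Context: Permutations are composed as maps; $\mathcal{S}_n$ is the symmetric group on $\{1,\dots,n\}$. -}

module Defs where

open import Level using (0ℓ)
open import Data.Nat.Base using (ℕ; zero; suc; _+_; _*_; _<_; _∸_)
open import Data.Fin.Base using (Fin)
open import Data.Fin.Permutation using (Permutation′; _⟨$⟩ʳ_)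
open import Data.Sum.Base using (_⊎_; inj₁; inj₂; [_,_]′)
open import Data.Product.Base using (Σ; ∃; _×_; _,_; proj₁; proj₂)
open import Function.Base using (_∘_; id)
open import Function.Bundles using (_⇔_; mk⇔; Equivalence)
open import Function.Definitions using (Injective)
open import Relation.Binary.Bundles using (Setoid)
open import Relation.Binary.PropositionalEquality
  using (_≡_; _≢_; refl; sym; trans; cong)

Perm : ℕ → Set
Perm n = Permutation′ n

iter : ∀ {A : Set} → ℕ → (A → A) → A → A
iter zero    f x = x
iter (suc k) f x = f (iter k f x)

_^_$_ : ∀ {n} → Perm n → ℕ → Fin n → Fin n
c ^ k $ x = iter k (c ⟨$⟩ʳ_) x

InSupport : ∀ {n} → Perm n → Fin n → Set
InSupport c x = c ⟨$⟩ʳ x ≢ x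

IsCycle : ∀ {n} → ℕ → Perm n → Set
IsCycle {n} m c =
  Σ (Fin n) λ x →
      (c ^ m $ x ≡ x)
    × (∀ i j → i < m → j < m → c ^ i $ x ≡ c ^ j $ x → i ≡ j)
    × (∀ y → InSupport c y → Σ ℕ λ i → i < m × y ≡ c ^ i $ x)

-- σ is a product of d disjoint transpositions (a₀ b₀)(a₁ b₁)...(a_{d-1} b_{d-1}):
-- the 2d points aᵢ, bᵢ are pairwise distinct, σ swaps aᵢ and bᵢ,
-- and σ fixes every other point.
IsProdDisjTransp : ∀ {n} → ℕ → Perm n → Set
IsProdDisjTransp {n} d σ =
  Σ (Fin d → Fin n) λ a → Σ (Fin d → Fin n) λ b →
      Injective _≡_ _≡_ (λ (p : Fin d ⊎ Fin d) → [ a , b ]′ p)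
    × (∀ i → σ ⟨$⟩ʳ a i ≡ b i)
    × (∀ i → σ ⟨$⟩ʳ b i ≡ a i)
    × (∀ y → (∀ i → y ≢ a i × y ≢ b i) → σ ⟨$⟩ʳ y ≡ y)

cycleSet : ∀ {n} → Perm n → ℕ → Fin n → Fin n → Set
cycleSet c h x y = (y ≡ x) ⊎ (y ≡ c ^ h $ x)

CyclesSetoid : ∀ {n} → Perm n → ℕ → Setoid 0ℓ 0ℓ
CyclesSetoid {n} c h = record
  { Carrier = Σ (Fin n) (InSupport c)
  ; _≈_ = λ p q → ∀ y → cycleSet c h (proj₁ p) y ⇔ cycleSet c h (proj₁ q) y
  ; isEquivalence = record
    { refl = λ y → mk⇔ id id
    ; sym = λ e y → mk⇔ (Equivalence.from (e y)) (Equivalence.to (e y))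
    ; trans = λ e f y → mk⇔ (Equivalence.to (f y) ∘ Equivalence.to (e y))
                            (Equivalence.from (e y) ∘ Equivalence.from (f y))
    }
  }

record Decomp {n} (c : Perm n) (h : ℕ) : Set where
  field
    σ τ   : Perm n
    σ-ok  : IsProdDisjTransp h σ
    τ-ok  : IsProdDisjTransp (h ∸ 1) τ
    fact  : ∀ x → c ⟨$⟩ʳ x ≡ σ ⟨$⟩ʳ (τ ⟨$⟩ʳ x)

DecompSetoid : ∀ {n} → Perm n → ℕ → Setoid 0ℓ 0ℓ
DecompSetoid {n} c h = record
  { Carrier = Decomp c h
  ; _≈_ = λ D E → (∀ x → Decomp.σ D ⟨$⟩ʳ x ≡ Decomp.σ E ⟨$⟩ʳ x)
                × (∀ x → Decomp.τ D ⟨$⟩ʳ x ≡ Decomp.τ E ⟨$⟩ʳ x)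
  ; isEquivalence = record
    { refl = (λ x → refl) , (λ x → refl)
    ; sym = λ e → (λ x → sym (proj₁ e x)) , (λ x → sym (proj₂ e x))
    ; trans = λ e f → (λ x → trans (proj₁ e x) (proj₁ f x))
                    , (λ x → trans (proj₂ e x) (proj₂ f x))
    }
  }

{-# OPTIONS --safe #-}
module Submission where

-- Write P i = c^i x₀ for the points of the cycle, indices taken modulo m = 2h.
-- For every k the reflection ρₖ : P i ↦ P (k - i) (the identity off the cycle) is
-- an involution with c = ρₖ₊₁ ∘ ρₖ.  As m is even, ρₖ has no fixed point on the
-- cycle when k is odd and exactly the two fixed points P j, P (j + h) when k = 2j,
-- so ρ₂ⱼ₊₁ ∘ ρ₂ⱼ (j < h) are h decompositions of the required shape.
-- Conversely, if c = σ τ with σ, τ involutions then c σ c = σ, so on the cycle σ is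
-- the reflection ρᵣ determined by σ x₀ = P r.  The involution τ = σ c = ρᵣ₋₁ moves
-- at most 2h - 2 points, so it fixes some P i, which forces r = 2i + 1 (mod m) to be
-- odd; then σ already moves all 2h points of the cycle and hence nothing else.
-- Finally the cycles {P i, P (i + h)} of c^h are indexed by i mod h.

open import Defs
open import Algebra.Definitions using (Involutive)
open import Data.Fin.Base using (Fin; zero; suc; toℕ; fromℕ<; splitAt; join; _↑ˡ_; _↑ʳ_)
open import Data.Fin.Permutation using (_⟨$⟩ʳ_; _⟨$⟩ˡ_; permutation; inverseˡ)
open import Data.Fin.Properties
  using (_≟_; any?; ¬∀⟶∃¬; injective⇒≤; join-splitAt; toℕ-injective; toℕ<n; toℕ-fromℕ<; fromℕ<-cong)
open import Data.Nat.Base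
  using (ℕ; NonZero; zero; suc; pred; _+_; _*_; _≤_; _<_; _%_; _/_; s≤s; z≤n; ⌊_/2⌋)
open import Data.Nat.Properties
  using (0≢1+n; 1+n≰n; n≤1+n; n<1+n; m≤m+n; m<m+n; ≤-trans; ≤-reflexive; <⇒≱; suc-injective;
         +-comm; +-assoc; +-suc; +-identityʳ; *-comm; +-mono-<-≤; +-monoʳ-≤; n≡⌊n+n/2⌋)
open import Data.Nat.DivMod
  using (_mod_; m≡m%n+[m/n]*n; m%n<n; m<n⇒m%n≡m; [m+n]%n≡m%n; [m+kn]%n≡m%n;
         %-distribˡ-+; %-distribˡ-*; m∣n⇒o%n%m≡o%m; m<n*o⇒m/o<n)
open import Data.Nat.Divisibility using (_∣_; n∣m*n; m∣m*n)
open import Data.Nat.Tactic.RingSolver using (solve-∀)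
open import Data.Product.Base using (Σ; ∃; _×_; _,_; proj₁; proj₂)
open import Data.Sum.Base as Sum using (_⊎_; inj₁; inj₂; [_,_]′)
open import Data.Vec.Functional using (Vector; []; _∷_; _++_)
open import Data.Vec.Functional.Properties using (lookup-++ˡ; lookup-++ʳ)
open import Data.Vec.Functional.Relation.Unary.All using (All)
import Data.Vec.Functional.Relation.Unary.All.Properties as All
open import Data.Vec.Functional.Relation.Unary.Any using (Any)
open import Function.Base using (_∘_)
open import Function.Bundles using (_⇔_; mk⇔; Equivalence; Inverse)
import Function.Construct.Composition as Composition
open import Function.Construct.Identity using (⇔-id)
open import Function.Definitions using (Injective)
open import Function.Properties.Equivalence using (⇔-setoid)
open import Level using (0ℓ)
open import Relation.Binary.Bundles using (Setoid)
import Relation.Binary.Reasoning.Setoid as SetoidReasoning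
open import Relation.Binary.PropositionalEquality
open import Relation.Nullary using (Dec; yes; no; ¬_; ¬?; contradiction)
open import Relation.Nullary.Decidable using (decidable-stable; _⊎-dec_; toSum)

iter-+ : ∀ {A : Set} a b (f : A → A) x → iter (a + b) f x ≡ iter a f (iter b f x)
iter-+ zero    b f x = refl
iter-+ (suc a) b f x = cong f (iter-+ a b f x)

iter-injective : ∀ {A : Set} {f : A → A} t → Injective _≡_ _≡_ f → Injective _≡_ _≡_ (iter t f)
iter-injective zero    f-inj eq = eq
iter-injective (suc t) f-inj eq = iter-injective t f-inj (f-inj eq)

involutive⇒injective : ∀ {A : Set} {f : A → A} → Involutive _≡_ f → Injective _≡_ _≡_ f
involutive⇒injective {f = f} f-involutive {x} {y} eq =
  trans (sym (f-involutive x)) (trans (cong f eq) (f-involutive y))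

module _ {a b ℓ₁ ℓ₂} (S : Setoid a ℓ₁) (T : Setoid b ℓ₂) where
  private
    module S = Setoid S
    module T = Setoid T

  strictlyInverse⇒Inverse : (to : S.Carrier → T.Carrier) (from : T.Carrier → S.Carrier) →
    (∀ x y → x S.≈ y → to x T.≈ to y) → (∀ x y → x T.≈ y → from x S.≈ from y) →
    (∀ y → to (from y) T.≈ y) → (∀ x → from (to x) S.≈ x) → Inverse S T
  strictlyInverse⇒Inverse to from to-cong from-cong to∘from from∘to = record
    { to        = to
    ; from      = from
    ; to-cong   = to-cong _ _
    ; from-cong = from-cong _ _
    ; inverse   = (λ {y} x≈from-y → T.trans (to-cong _ _ x≈from-y) (to∘from y))
                , (λ {x} y≈to-x → S.trans (from-cong _ _ y≈to-x) (from∘to x))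
    }

module _ {A : Set} where

  Distinct : ∀ {N} → Vector A N → Set
  Distinct xs = Injective _≡_ _≡_ xs

  infix 4 _∈_
  _∈_ : ∀ {N} → A → Vector A N → Set
  x ∈ xs = Any (x ≡_) xs

  Distinct-∷ : ∀ {N x} {xs : Vector A N} → All (x ≢_) xs → Distinct xs → Distinct (x ∷ xs)
  Distinct-∷ x∉xs xs-distinct {zero}  {zero}  eq = refl
  Distinct-∷ x∉xs xs-distinct {zero}  {suc j} eq = contradiction eq (x∉xs j)
  Distinct-∷ x∉xs xs-distinct {suc i} {zero}  eq = contradiction (sym eq) (x∉xs i)
  Distinct-∷ x∉xs xs-distinct {suc i} {suc j} eq = cong suc (xs-distinct eq)

  [,]-injective : ∀ {M N} {xs : Vector A M} {ys : Vector A N} → Distinct xs → Distinct ys →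
                  (∀ i j → xs i ≢ ys j) → Injective _≡_ _≡_ [ xs , ys ]′
  [,]-injective xs-distinct ys-distinct disjoint {inj₁ i} {inj₁ j} eq = cong inj₁ (xs-distinct eq)
  [,]-injective xs-distinct ys-distinct disjoint {inj₁ i} {inj₂ j} eq = contradiction eq (disjoint i j)
  [,]-injective xs-distinct ys-distinct disjoint {inj₂ i} {inj₁ j} eq = contradiction (sym eq) (disjoint j i)
  [,]-injective xs-distinct ys-distinct disjoint {inj₂ i} {inj₂ j} eq = cong inj₂ (ys-distinct eq)

  Distinct-++ : ∀ {M N} {xs : Vector A M} {ys : Vector A N} → Distinct xs → Distinct ys →
                (∀ i j → xs i ≢ ys j) → Distinct (xs ++ ys)
  Distinct-++ {M} {N} xs-distinct ys-distinct disjoint {i} {j} eq = begin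
    i                       ≡⟨ join-splitAt M N i ⟨
    join M N (splitAt M i)  ≡⟨ cong (join M N) (split-injective {splitAt M i} {splitAt M j} eq) ⟩
    join M N (splitAt M j)  ≡⟨ join-splitAt M N j ⟩
    j                       ∎
    where
    open ≡-Reasoning
    split-injective = [,]-injective xs-distinct ys-distinct disjoint

  Distinct-⊆⇒≤ : ∀ {M N} {xs : Vector A N} (ys : Vector A M) → Distinct xs → All (_∈ ys) xs → N ≤ M
  Distinct-⊆⇒≤ ys xs-distinct xs⊆ys = injective⇒≤ {f = proj₁ ∘ xs⊆ys} λ {i} {j} eq →
    xs-distinct (trans (proj₂ (xs⊆ys i)) (trans (cong ys eq) (sym (proj₂ (xs⊆ys j)))))

-- Products of disjoint transpositions

module ProdDisjTransp {n d} (ρ : Perm n) (ρ-prod : IsProdDisjTransp d ρ) where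

  private
    a b : Vector (Fin n) d
    a = proj₁ ρ-prod
    b = proj₁ (proj₂ ρ-prod)

    ρa≡b : ∀ i → ρ ⟨$⟩ʳ a i ≡ b i
    ρa≡b = proj₁ (proj₂ (proj₂ (proj₂ ρ-prod)))

    ρb≡a : ∀ i → ρ ⟨$⟩ʳ b i ≡ a i
    ρb≡a = proj₁ (proj₂ (proj₂ (proj₂ (proj₂ ρ-prod))))

    fixes-rest : ∀ y → (∀ i → y ≢ a i × y ≢ b i) → ρ ⟨$⟩ʳ y ≡ y
    fixes-rest = proj₂ (proj₂ (proj₂ (proj₂ (proj₂ ρ-prod))))

    in-pair-or-fixed : ∀ y → (∃ λ i → y ≡ a i ⊎ y ≡ b i) ⊎ ρ ⟨$⟩ʳ y ≡ y
    in-pair-or-fixed y with any? (λ i → y ≟ a i ⊎-dec y ≟ b i)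
    ... | yes found  = inj₁ found
    ... | no  ¬found = inj₂ (fixes-rest y λ i → (λ y≡a → ¬found (i , inj₁ y≡a))
                                             , (λ y≡b → ¬found (i , inj₂ y≡b)))

    moved∈pairs : ∀ y → ρ ⟨$⟩ʳ y ≢ y → y ∈ (a ++ b)
    moved∈pairs y moved with in-pair-or-fixed y
    ... | inj₁ (i , inj₁ y≡a) = i ↑ˡ d , trans y≡a (sym (lookup-++ˡ a b i))
    ... | inj₁ (i , inj₂ y≡b) = d ↑ʳ i , trans y≡b (sym (lookup-++ʳ a b i))
    ... | inj₂ fixed          = contradiction fixed moved

  involutive : Involutive _≡_ (ρ ⟨$⟩ʳ_)
  involutive y with in-pair-or-fixed y
  ... | inj₁ (i , inj₁ refl) = trans (cong (ρ ⟨$⟩ʳ_) (ρa≡b i)) (ρb≡a i)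
  ... | inj₁ (i , inj₂ refl) = trans (cong (ρ ⟨$⟩ʳ_) (ρb≡a i)) (ρa≡b i)
  ... | inj₂ fixed           = trans (cong (ρ ⟨$⟩ʳ_) fixed) fixed

  moved-count : ∀ {N} {xs : Vector (Fin n) N} → Distinct xs → All (λ x → ρ ⟨$⟩ʳ x ≢ x) xs → N ≤ d + d
  moved-count xs-distinct xs-moved = Distinct-⊆⇒≤ (a ++ b) xs-distinct (λ i → moved∈pairs _ (xs-moved i))

  fixes-one-of : ∀ {N} {xs : Vector (Fin n) N} → Distinct xs → d + d < N → ∃ λ i → ρ ⟨$⟩ʳ xs i ≡ xs i
  fixes-one-of {N} {xs} xs-distinct d+d<N
    with ¬∀⟶∃¬ N (λ i → ρ ⟨$⟩ʳ xs i ≢ xs i) (λ i → ¬? (ρ ⟨$⟩ʳ xs i ≟ xs i))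
               (λ all-moved → <⇒≱ d+d<N (moved-count xs-distinct all-moved))
  ... | i , ¬moved = i , decidable-stable (ρ ⟨$⟩ʳ xs i ≟ xs i) ¬moved

involution⇒IsProdDisjTransp : ∀ {n d} (ρ : Perm n) → Involutive _≡_ (ρ ⟨$⟩ʳ_) →
  (a : Vector (Fin n) d) → Distinct a → (∀ s t → a s ≢ ρ ⟨$⟩ʳ a t) →
  (∀ y → (∀ s → y ≢ a s × y ≢ ρ ⟨$⟩ʳ a s) → ρ ⟨$⟩ʳ y ≡ y) → IsProdDisjTransp d ρ
involution⇒IsProdDisjTransp ρ ρ-involutive a a-distinct a∩ρa≡∅ fixes-rest =
  a , (ρ ⟨$⟩ʳ_) ∘ a , [,]-injective a-distinct ρa-distinct a∩ρa≡∅ ,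
  (λ _ → refl) , (λ s → ρ-involutive (a s)) , fixes-rest
  where
  ρa-distinct : Distinct ((ρ ⟨$⟩ʳ_) ∘ a)
  ρa-distinct = a-distinct ∘ involutive⇒injective {f = ρ ⟨$⟩ʳ_} ρ-involutive

-- Factorisations into two involutions

module _ {A : Set} (c : A → A) where

  Reverses : (A → A) → Set
  Reverses σ = ∀ z → c (σ (c z)) ≡ σ z

  factorisation-reverses : ∀ {σ τ} → (∀ x → c x ≡ σ (τ x)) → Involutive _≡_ σ → Involutive _≡_ τ →
                           Reverses σ × Reverses τ
  factorisation-reverses {σ} {τ} c≗στ σ² τ² =
    (λ z → begin
      c (σ (c z))           ≡⟨ c≗στ _ ⟩
      σ (τ (σ (c z)))       ≡⟨ cong (σ ∘ τ ∘ σ) (c≗στ z) ⟩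
      σ (τ (σ (σ (τ z))))   ≡⟨ cong (σ ∘ τ) (σ² (τ z)) ⟩
      σ (τ (τ z))           ≡⟨ cong σ (τ² z) ⟩
      σ z                   ∎) ,
    (λ z → begin
      c (τ (c z))           ≡⟨ c≗στ _ ⟩
      σ (τ (τ (c z)))       ≡⟨ cong σ (τ² (c z)) ⟩
      σ (c z)               ≡⟨ cong σ (c≗στ z) ⟩
      σ (σ (τ z))           ≡⟨ σ² (τ z) ⟩
      τ z                   ∎)
    where open ≡-Reasoning

  reverses-agree-on-orbit : Injective _≡_ _≡_ c → ∀ {σ σ′} → Reverses σ → Reverses σ′ →
                            ∀ {x} → σ x ≡ σ′ x → ∀ i → σ (iter i c x) ≡ σ′ (iter i c x)
  reverses-agree-on-orbit c-inj σ-rev σ′-rev σx≡σ′x zero    = σx≡σ′x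
  reverses-agree-on-orbit c-inj {σ} {σ′} σ-rev σ′-rev {x} σx≡σ′x (suc i) = c-inj (begin
    c (σ (c y))    ≡⟨ σ-rev y ⟩
    σ y            ≡⟨ reverses-agree-on-orbit c-inj σ-rev σ′-rev σx≡σ′x i ⟩
    σ′ y           ≡⟨ σ′-rev y ⟨
    c (σ′ (c y))   ∎)
    where
    open ≡-Reasoning
    y : A
    y = iter i c x

-- The orbit of an even cycle and its reflections

suc-+<2* : ∀ {h s t} → s < h → t < h → suc (s + t) < 2 * h
suc-+<2* {h} {s} {t} s<h t<h =
  subst₂ _<_ (+-suc s t) (cong (h +_) (sym (+-identityʳ h))) (+-mono-<-≤ s<h t<h)

module Cycle {n h′} (c : Perm n) (c-cycle : IsCycle (2 * suc h′) c) where

  h m w : ℕ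
  h = suc h′
  m = 2 * h
  -- w ≡ -1 (mod m), so P (k + w * i) is the point P (k - i); suc w reduces to m.
  w = pred m

  C : Fin n → Fin n
  C = c ⟨$⟩ʳ_

  x₀ : Fin n
  x₀ = proj₁ c-cycle

  P : ℕ → Fin n
  P i = c ^ i $ x₀

  period : P m ≡ x₀
  period = proj₁ (proj₂ c-cycle)

  P-injective : ∀ {a b} → a < m → b < m → P a ≡ P b → a ≡ b
  P-injective = proj₁ (proj₂ (proj₂ c-cycle)) _ _

  support : ∀ y → InSupport c y → Σ ℕ λ i → i < m × y ≡ P i
  support = proj₂ (proj₂ (proj₂ c-cycle))

  C-injective : Injective _≡_ _≡_ C
  C-injective eq = trans (sym (inverseˡ c)) (trans (cong (c ⟨$⟩ˡ_) eq) (inverseˡ c))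

  P-+ : ∀ a b → P (a + b) ≡ iter a C (P b)
  P-+ a b = iter-+ a b C x₀

  P-+-cancelˡ : ∀ t {a b} → P (t + a) ≡ P (t + b) → P a ≡ P b
  P-+-cancelˡ t {a} {b} eq = iter-injective t C-injective (trans (sym (P-+ t a)) (trans eq (P-+ t b)))

  P-periodic : ∀ q a → P (q * m + a) ≡ P a
  P-periodic zero    a = refl
  P-periodic (suc q) a = begin
    P (m + q * m + a)         ≡⟨ cong P (trans (+-assoc m (q * m) a) (+-comm m (q * m + a))) ⟩
    P (q * m + a + m)         ≡⟨ P-+ (q * m + a) m ⟩
    iter (q * m + a) C (P m)  ≡⟨ cong (iter (q * m + a) C) period ⟩
    P (q * m + a)             ≡⟨ P-periodic q a ⟩
    P a                       ∎
    where open ≡-Reasoning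

  P-% : ∀ a → P a ≡ P (a % m)
  P-% a = trans (cong P (trans (m≡m%n+[m/n]*n a m) (+-comm (a % m) _))) (P-periodic (a / m) (a % m))

  %-≡⇒P-≡ : ∀ a b → a % m ≡ b % m → P a ≡ P b
  %-≡⇒P-≡ a b eq = trans (P-% a) (trans (cong P eq) (sym (P-% b)))

  P-≡⇒%-≡ : ∀ a b → P a ≡ P b → a % m ≡ b % m
  P-≡⇒%-≡ a b eq = P-injective (m%n<n a m) (m%n<n b m) (trans (sym (P-% a)) (trans eq (P-% b)))

  P-≡⇒%-≡-∣ : ∀ {d} .{{_ : NonZero d}} a b → d ∣ m → P a ≡ P b → a % d ≡ b % d
  P-≡⇒%-≡-∣ {d} a b d∣m eq = begin
    a % d      ≡⟨ m∣n⇒o%n%m≡o%m d m a d∣m ⟨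
    a % m % d  ≡⟨ cong (_% d) (P-≡⇒%-≡ a b eq) ⟩
    b % m % d  ≡⟨ m∣n⇒o%n%m≡o%m d m b d∣m ⟩
    b % d      ∎
    where open ≡-Reasoning

  P-suc-+-≢ : ∀ e x → suc e < m → P (suc e + x) ≢ P x
  P-suc-+-≢ e x e<m eq with P-injective e<m (s≤s z≤n) (P-+-cancelˡ x (begin
    P (x + suc e)  ≡⟨ cong P (+-comm x (suc e)) ⟩
    P (suc e + x)  ≡⟨ eq ⟩
    P x            ≡⟨ cong P (+-identityʳ x) ⟨
    P (x + 0)      ∎))
    where open ≡-Reasoning
  ... | ()

  1<m : 1 < m
  1<m = suc-+<2* {h} {0} {0} (s≤s z≤n) (s≤s z≤n)

  h<m : h < m
  h<m = m<m+n h (s≤s z≤n)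

  2h′<m : h′ + h′ < m
  2h′<m = ≤-trans (n≤1+n _) (suc-+<2* (n<1+n h′) (n<1+n h′))

  P-moved : ∀ i → InSupport c (P i)
  P-moved i = P-suc-+-≢ 0 i 1<m

  orbit : Vector (Fin n) m
  orbit i = P (toℕ i)

  orbit-distinct : Distinct orbit
  orbit-distinct eq = toℕ-injective (P-injective (toℕ<n _) (toℕ<n _) eq)

  _∈orbit? : ∀ y → Dec (y ∈ orbit)
  y ∈orbit? = any? (λ i → y ≟ orbit i)

  orbit-cases : ∀ y → y ∈ orbit ⊎ ¬ y ∈ orbit
  orbit-cases y = toSum (y ∈orbit?)

  P∈orbit : ∀ a → P a ∈ orbit
  P∈orbit a = fromℕ< (m%n<n a m) , trans (P-% a) (cong P (sym (toℕ-fromℕ< (m%n<n a m))))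

  support⊆orbit : ∀ {y} → InSupport c y → y ∈ orbit
  support⊆orbit {y} y∈supp with support y y∈supp
  ... | i , i<m , y≡Pi = fromℕ< i<m , trans y≡Pi (cong P (sym (toℕ-fromℕ< i<m)))

  C-fixes-off-orbit : ∀ {y} → ¬ y ∈ orbit → C y ≡ y
  C-fixes-off-orbit {y} y∉orbit = decidable-stable (C y ≟ y) (y∉orbit ∘ support⊆orbit)

  reflect : ℕ → Fin n → Fin n
  reflect k y with y ∈orbit?
  ... | yes (i , _) = P (k + w * toℕ i)
  ... | no  _       = y

  reflect-index-cong : ∀ k {a b} → a % m ≡ b % m → P (k + w * a) ≡ P (k + w * b)
  reflect-index-cong k {a} {b} eq = %-≡⇒P-≡ (k + w * a) (k + w * b) (begin
    (k + w * a) % m            ≡⟨ %-distribˡ-+ k (w * a) m ⟩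
    (k % m + (w * a) % m) % m  ≡⟨ cong (λ x → (k % m + x) % m) w*-cong ⟩
    (k % m + (w * b) % m) % m  ≡⟨ %-distribˡ-+ k (w * b) m ⟨
    (k + w * b) % m            ∎)
    where
    open ≡-Reasoning
    w*-cong : (w * a) % m ≡ (w * b) % m
    w*-cong = trans (%-distribˡ-* w a m)
                (trans (cong (λ x → (w % m * x) % m) eq) (sym (%-distribˡ-* w b m)))

  reflect-P : ∀ k b → reflect k (P b) ≡ P (k + w * b)
  reflect-P k b with P b ∈orbit?
  ... | yes (i , Pb≡Pi) = reflect-index-cong k (sym (P-≡⇒%-≡ b (toℕ i) Pb≡Pi))
  ... | no  Pb∉orbit    = contradiction (P∈orbit b) Pb∉orbit

  reflect-off-orbit : ∀ k {y} → ¬ y ∈ orbit → reflect k y ≡ y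
  reflect-off-orbit k {y} y∉orbit with y ∈orbit?
  ... | yes y∈orbit = contradiction y∈orbit y∉orbit
  ... | no  _       = refl

  reflect-moved⇒∈orbit : ∀ k {y} → reflect k y ≢ y → y ∈ orbit
  reflect-moved⇒∈orbit k {y} moved = decidable-stable (y ∈orbit?) (moved ∘ reflect-off-orbit k)

  P-reflect-sum : ∀ k b → P (b + (k + w * b)) ≡ P k
  P-reflect-sum k b = trans (cong P (regroup w b k)) (P-periodic b k)
    where
    regroup : ∀ w b k → b + (k + w * b) ≡ b * suc w + k
    regroup = solve-∀

  reflect-swap : ∀ k a b → P (a + b) ≡ P k → reflect k (P b) ≡ P a
  reflect-swap k a b eq = trans (reflect-P k b) (P-+-cancelˡ b {k + w * b} {a} (begin
    P (b + (k + w * b))  ≡⟨ P-reflect-sum k b ⟩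
    P k                  ≡⟨ eq ⟨
    P (a + b)            ≡⟨ cong P (+-comm a b) ⟩
    P (b + a)            ∎))
    where open ≡-Reasoning

  reflect-swap⁻¹ : ∀ k a b → reflect k (P b) ≡ P a → P (a + b) ≡ P k
  reflect-swap⁻¹ k a b eq = begin
    P (a + b)                 ≡⟨ cong P (+-comm a b) ⟩
    P (b + a)                 ≡⟨ P-+ b a ⟩
    iter b C (P a)            ≡⟨ cong (iter b C) (trans (sym eq) (reflect-P k b)) ⟩
    iter b C (P (k + w * b))  ≡⟨ P-+ b _ ⟨
    P (b + (k + w * b))       ≡⟨ P-reflect-sum k b ⟩
    P k                       ∎
    where open ≡-Reasoning

  reflect-parity : ∀ k a b → reflect k (P b) ≡ P a → (a + b) % 2 ≡ k % 2
  reflect-parity k a b eq = P-≡⇒%-≡-∣ (a + b) k (m∣m*n h) (reflect-swap⁻¹ k a b eq)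

  reflect-involutive : ∀ k → Involutive _≡_ (reflect k)
  reflect-involutive k y with orbit-cases y
  ... | inj₁ (i , refl) = trans (cong (reflect k) (reflect-P k (toℕ i)))
                                (reflect-swap k (toℕ i) _ (P-reflect-sum k (toℕ i)))
  ... | inj₂ y∉orbit    = trans (cong (reflect k) (reflect-off-orbit k y∉orbit))
                                (reflect-off-orbit k y∉orbit)

  reflectPerm : ℕ → Perm n
  reflectPerm k = permutation (reflect k) (reflect k) (reflect-involutive k) (reflect-involutive k)

  reflect-factorisation : ∀ k x → C x ≡ reflect (suc k) (reflect k x)
  reflect-factorisation k x with orbit-cases x
  ... | inj₁ (i , refl) = sym (trans (cong (reflect (suc k)) (reflect-P k (toℕ i)))
                                     (reflect-swap (suc k) (suc (toℕ i)) _ (cong C (P-reflect-sum k (toℕ i)))))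
  ... | inj₂ x∉orbit    = trans (C-fixes-off-orbit x∉orbit) (sym (begin
    reflect (suc k) (reflect k x)  ≡⟨ cong (reflect (suc k)) (reflect-off-orbit k x∉orbit) ⟩
    reflect (suc k) x              ≡⟨ reflect-off-orbit (suc k) x∉orbit ⟩
    x                              ∎))
    where open ≡-Reasoning

  reflect-reverses : ∀ k → Reverses C (reflect k)
  reflect-reverses k = proj₂ (factorisation-reverses C {reflect (suc k)} {reflect k}
    (reflect-factorisation k) (reflect-involutive (suc k)) (reflect-involutive k))

  reflect-IsProdDisjTransp : ∀ k {f d} (z : Vector (Fin n) f) (a : Vector (Fin n) d) → m ≤ f + (d + d) →
    Distinct z → All (λ x → reflect k x ≡ x) z → All (_∈ orbit) z →
    Distinct a → (∀ s t → a s ≢ reflect k (a t)) → IsProdDisjTransp d (reflectPerm k)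
  reflect-IsProdDisjTransp k {f} {d} z a m≤f+2d z-distinct z-fixed z∈orbit a-distinct a∩ρa≡∅ =
    involution⇒IsProdDisjTransp (reflectPerm k) ρ-involutive a a-distinct a∩ρa≡∅ fixes-rest
    where
    ρ : Fin n → Fin n
    ρ = reflect k

    ρ-involutive : Involutive _≡_ ρ
    ρ-involutive = reflect-involutive k

    pairs : Vector (Fin n) (d + d)
    pairs = a ++ (ρ ∘ a)

    pairs-moved : All (λ x → ρ x ≢ x) pairs
    pairs-moved = All.++⁺ (λ x → ρ x ≢ x) (λ s eq → a∩ρa≡∅ s s (sym eq))
                                          (λ s eq → a∩ρa≡∅ s s (trans (sym (ρ-involutive (a s))) eq))

    points : Vector (Fin n) (f + (d + d))
    points = z ++ pairs

    points-distinct : Distinct points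
    points-distinct = Distinct-++ z-distinct
      (Distinct-++ a-distinct (a-distinct ∘ involutive⇒injective {f = ρ} ρ-involutive) a∩ρa≡∅)
      (λ i j eq → pairs-moved j (trans (cong ρ (sym eq)) (trans (z-fixed i) eq)))

    points∈orbit : All (_∈ orbit) points
    points∈orbit = All.++⁺ (_∈ orbit) z∈orbit (reflect-moved⇒∈orbit k ∘ pairs-moved)

    fixes-rest : ∀ y → (∀ s → y ≢ a s × y ≢ ρ (a s)) → ρ y ≡ y
    fixes-rest y y∉pairs = decidable-stable (ρ y ≟ y) λ moved →
      1+n≰n (≤-trans (Distinct-⊆⇒≤ orbit (Distinct-∷ (y∉points moved) points-distinct)
                       (λ { zero → reflect-moved⇒∈orbit k moved ; (suc i) → points∈orbit i }))
                     m≤f+2d)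
      where
      y∉points : ρ y ≢ y → All (y ≢_) points
      y∉points moved = All.++⁺ (y ≢_) (λ i eq → moved (trans (cong ρ eq) (trans (z-fixed i) (sym eq))))
                                      (All.++⁺ (y ≢_) (proj₁ ∘ y∉pairs) (proj₂ ∘ y∉pairs))

  arc : ℕ → ∀ {d} → Vector (Fin n) d
  arc e s = P (e + toℕ s)

  arc-distinct : ∀ e {d} → d ≤ m → Distinct (arc e {d})
  arc-distinct e d≤m {s} {t} eq = toℕ-injective
    (P-injective (≤-trans (toℕ<n s) d≤m) (≤-trans (toℕ<n t) d≤m) (P-+-cancelˡ e eq))

  reflect-odd-IsProdDisjTransp : ∀ j → IsProdDisjTransp h (reflectPerm (suc (j + j)))
  reflect-odd-IsProdDisjTransp j = reflect-IsProdDisjTransp k [] (arc (suc j))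
    (≤-reflexive (cong (h +_) (+-identityʳ h))) (λ { {()} }) (λ ()) (λ ())
    (arc-distinct (suc j) (m≤m+n h _)) disjoint
    where
    k : ℕ
    k = suc (j + j)
    sum : ∀ j s t → suc (s + t) + suc (j + j) ≡ (suc j + s) + (suc j + t)
    sum = solve-∀
    disjoint : ∀ s t → arc (suc j) s ≢ reflect k (arc (suc j) t)
    disjoint s t eq = P-suc-+-≢ (toℕ s + toℕ t) k (suc-+<2* (toℕ<n s) (toℕ<n t))
      (trans (cong P (sum j (toℕ s) (toℕ t)))
             (reflect-swap⁻¹ k (suc j + toℕ s) (suc j + toℕ t) (sym eq)))

  reflect-even-IsProdDisjTransp : ∀ j → IsProdDisjTransp h′ (reflectPerm (j + j))
  reflect-even-IsProdDisjTransp j = reflect-IsProdDisjTransp k fixed (arc (suc j))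
    (≤-reflexive (m≡2+2h′ h′)) fixed-distinct fixed-fixed fixed∈orbit
    (arc-distinct (suc j) (≤-trans (n≤1+n h′) (m≤m+n h _))) disjoint
    where
    k : ℕ
    k = j + j
    m≡2+2h′ : ∀ h′ → 2 * suc h′ ≡ 2 + (h′ + h′)
    m≡2+2h′ = solve-∀
    sum : ∀ j s t → suc (suc (s + t)) + (j + j) ≡ (suc j + s) + (suc j + t)
    sum = solve-∀
    antipode : ∀ h j → (h + j) + (h + j) ≡ 1 * (2 * h) + (j + j)
    antipode = solve-∀

    fixed : Vector (Fin n) 2
    fixed = P j ∷ P (h + j) ∷ []

    fixed-distinct : Distinct fixed
    fixed-distinct = Distinct-∷ (λ { zero → P-suc-+-≢ h′ j h<m ∘ sym ; (suc ()) })
                                (Distinct-∷ (λ ()) (λ { {()} }))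

    fixed-fixed : All (λ x → reflect k x ≡ x) fixed
    fixed-fixed zero       = reflect-swap k j j refl
    fixed-fixed (suc zero) = reflect-swap k (h + j) (h + j) (trans (cong P (antipode h j)) (P-periodic 1 k))

    fixed∈orbit : All (_∈ orbit) fixed
    fixed∈orbit zero       = P∈orbit j
    fixed∈orbit (suc zero) = P∈orbit (h + j)

    disjoint : ∀ s t → arc (suc j) s ≢ reflect k (arc (suc j) t)
    disjoint s t eq = P-suc-+-≢ (suc (toℕ s + toℕ t)) k
      (s≤s (≤-trans (suc-+<2* (toℕ<n s) (toℕ<n t)) (+-monoʳ-≤ h′ (n≤1+n _))))
      (trans (cong P (sum j (toℕ s) (toℕ t)))
             (reflect-swap⁻¹ k (suc j + toℕ s) (suc j + toℕ t) (sym eq)))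

  reflectDecomp : ℕ → Decomp c h
  reflectDecomp j = record
    { σ    = reflectPerm (suc (j + j))
    ; τ    = reflectPerm (j + j)
    ; σ-ok = reflect-odd-IsProdDisjTransp j
    ; τ-ok = reflect-even-IsProdDisjTransp j
    ; fact = reflect-factorisation (j + j)
    }

  -- Decompositions are pairs of reflections

  module DecompIsReflection (D : Decomp c h) where
    open Decomp D

    σ-involutive : Involutive _≡_ (σ ⟨$⟩ʳ_)
    σ-involutive = ProdDisjTransp.involutive σ σ-ok

    τ≗σ∘C : ∀ x → τ ⟨$⟩ʳ x ≡ σ ⟨$⟩ʳ C x
    τ≗σ∘C x = trans (sym (σ-involutive _)) (cong (σ ⟨$⟩ʳ_) (sym (fact x)))

    σ-reverses : Reverses C (σ ⟨$⟩ʳ_)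
    σ-reverses = proj₁ (factorisation-reverses C fact σ-involutive (ProdDisjTransp.involutive τ τ-ok))

    σx₀∈orbit : σ ⟨$⟩ʳ x₀ ∈ orbit
    σx₀∈orbit = support⊆orbit λ C-fixes → P-suc-+-≢ 0 0 1<m
      (involutive⇒injective {f = σ ⟨$⟩ʳ_} σ-involutive (C-injective (trans (σ-reverses x₀) (sym C-fixes))))

    r : ℕ
    r = toℕ (proj₁ σx₀∈orbit)

    r<m : r < m
    r<m = toℕ<n _

    r-unique : ∀ {k} → k < m → σ ⟨$⟩ʳ x₀ ≡ P k → r ≡ k
    r-unique k<m σx₀≡Pk = P-injective r<m k<m (trans (sym (proj₂ σx₀∈orbit)) σx₀≡Pk)

    σ≗reflect-on-orbit : ∀ i → σ ⟨$⟩ʳ P i ≡ reflect r (P i)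
    σ≗reflect-on-orbit = reverses-agree-on-orbit C C-injective σ-reverses (reflect-reverses r)
      (trans (proj₂ σx₀∈orbit) (sym (reflect-swap r r 0 (cong P (+-identityʳ r)))))

    r-odd : r % 2 ≡ 1
    r-odd with ProdDisjTransp.fixes-one-of τ τ-ok orbit-distinct 2h′<m
    ... | i , τ-fixes = begin
      r % 2                      ≡⟨ reflect-parity r (toℕ i) (suc (toℕ i)) reflected ⟨
      (toℕ i + suc (toℕ i)) % 2  ≡⟨ cong (_% 2) (odd (toℕ i)) ⟩
      (1 + toℕ i * 2) % 2        ≡⟨ [m+kn]%n≡m%n 1 (toℕ i) 2 ⟩
      1                          ∎
      where
      open ≡-Reasoning
      odd : ∀ i → i + suc i ≡ 1 + i * 2
      odd = solve-∀
      reflected : reflect r (P (suc (toℕ i))) ≡ P (toℕ i)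
      reflected = trans (sym (σ≗reflect-on-orbit (suc (toℕ i)))) (trans (sym (τ≗σ∘C _)) τ-fixes)

    σ-moves-orbit : All (λ x → σ ⟨$⟩ʳ x ≢ x) orbit
    σ-moves-orbit i σ-fixes = 0≢1+n (begin
      0                    ≡⟨ [m+kn]%n≡m%n 0 (toℕ i) 2 ⟨
      (0 + toℕ i * 2) % 2  ≡⟨ cong (_% 2) (even (toℕ i)) ⟩
      (toℕ i + toℕ i) % 2  ≡⟨ reflect-parity r (toℕ i) (toℕ i) reflected ⟩
      r % 2                ≡⟨ r-odd ⟩
      1                    ∎)
      where
      open ≡-Reasoning
      even : ∀ i → 0 + i * 2 ≡ i + i
      even = solve-∀
      reflected : reflect r (orbit i) ≡ orbit i
      reflected = trans (sym (σ≗reflect-on-orbit (toℕ i))) σ-fixes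

    σ-fixes-off-orbit : ∀ {x} → ¬ x ∈ orbit → σ ⟨$⟩ʳ x ≡ x
    σ-fixes-off-orbit {x} x∉orbit = decidable-stable (σ ⟨$⟩ʳ x ≟ x) λ moved →
      1+n≰n (subst (suc m ≤_) (cong (h +_) (sym (+-identityʳ h)))
        (ProdDisjTransp.moved-count σ σ-ok (Distinct-∷ (λ i eq → x∉orbit (i , eq)) orbit-distinct)
                                           (λ { zero → moved ; (suc i) → σ-moves-orbit i })))

    σ≗reflect : ∀ x → σ ⟨$⟩ʳ x ≡ reflect r x
    σ≗reflect x with orbit-cases x
    ... | inj₁ (i , refl) = σ≗reflect-on-orbit (toℕ i)
    ... | inj₂ x∉orbit    = trans (σ-fixes-off-orbit x∉orbit) (sym (reflect-off-orbit r x∉orbit))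

    j : ℕ
    j = r / 2

    r≡2j+1 : r ≡ suc (j + j)
    r≡2j+1 = begin
      r              ≡⟨ m≡m%n+[m/n]*n r 2 ⟩
      r % 2 + j * 2  ≡⟨ cong (_+ j * 2) r-odd ⟩
      1 + j * 2      ≡⟨ double j ⟩
      suc (j + j)    ∎
      where
      open ≡-Reasoning
      double : ∀ j → 1 + j * 2 ≡ suc (j + j)
      double = solve-∀

    j<h : j < h
    j<h = m<n*o⇒m/o<n (subst (r <_) (*-comm 2 h) r<m)

    j-unique : ∀ {k} → r ≡ suc (k + k) → j ≡ k
    j-unique {k} r≡2k+1 = begin
      j            ≡⟨ n≡⌊n+n/2⌋ j ⟩
      ⌊ j + j /2⌋  ≡⟨ cong ⌊_/2⌋ (suc-injective (trans (sym r≡2j+1) r≡2k+1)) ⟩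
      ⌊ k + k /2⌋  ≡⟨ n≡⌊n+n/2⌋ k ⟨
      k            ∎
      where open ≡-Reasoning

    σ≗reflect-odd : ∀ x → σ ⟨$⟩ʳ x ≡ reflect (suc (j + j)) x
    σ≗reflect-odd x = trans (σ≗reflect x) (cong (λ k → reflect k x) r≡2j+1)

    τ≗reflect-even : ∀ x → τ ⟨$⟩ʳ x ≡ reflect (j + j) x
    τ≗reflect-even x = begin
      τ ⟨$⟩ʳ x                               ≡⟨ τ≗σ∘C x ⟩
      σ ⟨$⟩ʳ C x                             ≡⟨ σ≗reflect-odd (C x) ⟩
      reflect (suc k) (C x)                  ≡⟨ cong (reflect (suc k)) (reflect-factorisation k x) ⟩
      reflect (suc k) (reflect (suc k) (reflect k x))  ≡⟨ reflect-involutive (suc k) _ ⟩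
      reflect k x                            ∎
      where
      open ≡-Reasoning
      k : ℕ
      k = j + j

  Fin↔Decomp : Inverse (setoid (Fin h)) (DecompSetoid c h)
  Fin↔Decomp = strictlyInverse⇒Inverse (setoid (Fin h)) (DecompSetoid c h) (reflectDecomp ∘ toℕ) from
    (λ { _ _ refl → (λ _ → refl) , (λ _ → refl) }) from-cong to∘from from∘to
    where
    open DecompIsReflection

    from : Decomp c h → Fin h
    from D = fromℕ< (j<h D)

    from-cong : ∀ D E → Setoid._≈_ (DecompSetoid c h) D E → from D ≡ from E
    from-cong D E (σ≗ , _) = fromℕ<-cong _ _ (cong (_/ 2) (r-unique D (r<m E)
      (trans (σ≗ x₀) (proj₂ (σx₀∈orbit E))))) (j<h D) (j<h E)

    to∘from : ∀ D → Setoid._≈_ (DecompSetoid c h) (reflectDecomp (toℕ (from D))) D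
    to∘from D =
      (λ x → trans (cong (λ k → reflect (suc (k + k)) x) (toℕ-fromℕ< (j<h D))) (sym (σ≗reflect-odd D x))) ,
      (λ x → trans (cong (λ k → reflect (k + k) x) (toℕ-fromℕ< (j<h D))) (sym (τ≗reflect-even D x)))

    from∘to : ∀ k → from (reflectDecomp (toℕ k)) ≡ k
    from∘to k = toℕ-injective (trans (toℕ-fromℕ< (j<h D)) (j-unique D (r-unique D 2k+1<m σx₀≡P[2k+1])))
      where
      D : Decomp c h
      D = reflectDecomp (toℕ k)
      2k+1 : ℕ
      2k+1 = suc (toℕ k + toℕ k)
      2k+1<m : 2k+1 < m
      2k+1<m = suc-+<2* (toℕ<n k) (toℕ<n k)
      σx₀≡P[2k+1] : reflect 2k+1 x₀ ≡ P 2k+1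
      σx₀≡P[2k+1] = reflect-swap 2k+1 2k+1 0 (cong P (+-identityʳ 2k+1))

  -- The cycles of c^h

  index : Σ (Fin n) (InSupport c) → ℕ
  index (x , x∈supp) = proj₁ (support x x∈supp)

  ≡P-index : ∀ p → proj₁ p ≡ P (index p)
  ≡P-index (x , x∈supp) = proj₂ (proj₂ (support x x∈supp))

  pair : ℕ → Fin n → Set
  pair a = cycleSet c h (P a)

  pair-swap : ∀ a y → pair a y ⇔ pair (h + a) y
  pair-swap a y = mk⇔ (Sum.swap ∘ Sum.map (λ y≡ → trans y≡ (sym back)) (λ y≡ → trans y≡ forth))
                      (Sum.map (λ y≡ → trans y≡ back) (λ y≡ → trans y≡ (sym forth)) ∘ Sum.swap)
    where
    twice : ∀ h a → h + (h + a) ≡ 1 * (2 * h) + a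
    twice = solve-∀
    forth : iter h C (P a) ≡ P (h + a)
    forth = sym (P-+ h a)
    back : iter h C (P (h + a)) ≡ P a
    back = trans (sym (P-+ h (h + a))) (trans (cong P (twice h a)) (P-periodic 1 a))

  pair-+* : ∀ q a y → pair (q * h + a) y ⇔ pair a y
  pair-+* zero    a y = ⇔-id _
  pair-+* (suc q) a y = begin
    pair (h + q * h + a) y    ≡⟨ cong (λ b → pair b y) (+-assoc h (q * h) a) ⟩
    pair (h + (q * h + a)) y  ≈⟨ pair-swap (q * h + a) y ⟨
    pair (q * h + a) y        ≈⟨ pair-+* q a y ⟩
    pair a y                  ∎
    where open SetoidReasoning (⇔-setoid 0ℓ)

  pair-% : ∀ a y → pair a y ⇔ pair (a % h) y
  pair-% a y = subst (λ b → pair b y ⇔ pair (a % h) y)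
                     (trans (+-comm _ (a % h)) (sym (m≡m%n+[m/n]*n a h))) (pair-+* (a / h) (a % h) y)

  ∈pair⇒%-≡ : ∀ a b → pair b (P a) → a % h ≡ b % h
  ∈pair⇒%-≡ a b (inj₁ Pa≡Pb)  = P-≡⇒%-≡-∣ a b (n∣m*n 2) Pa≡Pb
  ∈pair⇒%-≡ a b (inj₂ Pa≡ChPb) = begin
    a % h        ≡⟨ P-≡⇒%-≡-∣ a (h + b) (n∣m*n 2) (trans Pa≡ChPb (sym (P-+ h b))) ⟩
    (h + b) % h  ≡⟨ cong (_% h) (+-comm h b) ⟩
    (b + h) % h  ≡⟨ [m+n]%n≡m%n b h ⟩
    b % h        ∎
    where open ≡-Reasoning

  Cycles↔Fin : Inverse (CyclesSetoid c h) (setoid (Fin h))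
  Cycles↔Fin = strictlyInverse⇒Inverse (CyclesSetoid c h) (setoid (Fin h)) to from
    to-cong (λ { _ _ refl _ → ⇔-id _ }) to∘from from∘to
    where
    to : Σ (Fin n) (InSupport c) → Fin h
    to p = index p mod h

    from : Fin h → Σ (Fin n) (InSupport c)
    from k = P (toℕ k) , P-moved (toℕ k)

    cycleSet⇔pair : ∀ p y → cycleSet c h (proj₁ p) y ⇔ pair (index p) y
    cycleSet⇔pair p y = subst (λ x → cycleSet c h x y ⇔ pair (index p) y) (sym (≡P-index p)) (⇔-id _)

    to-cong : ∀ p q → (∀ y → cycleSet c h (proj₁ p) y ⇔ cycleSet c h (proj₁ q) y) → to p ≡ to q
    to-cong p q p≈q = fromℕ<-cong _ _ (∈pair⇒%-≡ (index p) (index q) Pp∈pair-q) _ _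
      where
      y : Fin n
      y = P (index p)
      Pp∈pair-q : pair (index q) y
      Pp∈pair-q = Equivalence.to (cycleSet⇔pair q y)
                    (Equivalence.to (p≈q y) (Equivalence.from (cycleSet⇔pair p y) (inj₁ refl)))

    to∘from : ∀ k → to (from k) ≡ k
    to∘from k = toℕ-injective (begin
      toℕ (index (from k) mod h)  ≡⟨ toℕ-fromℕ< _ ⟩
      index (from k) % h          ≡⟨ P-≡⇒%-≡-∣ (index (from k)) (toℕ k) (n∣m*n 2) (sym (≡P-index (from k))) ⟩
      toℕ k % h                   ≡⟨ m<n⇒m%n≡m (toℕ<n k) ⟩
      toℕ k                       ∎)
      where open ≡-Reasoning

    from∘to : ∀ p y → pair (toℕ (to p)) y ⇔ cycleSet c h (proj₁ p) y
    from∘to p y = begin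
      pair (toℕ (index p mod h)) y  ≡⟨ cong (λ b → pair b y) (toℕ-fromℕ< (m%n<n (index p) h)) ⟩
      pair (index p % h) y          ≈⟨ pair-% (index p) y ⟨
      pair (index p) y              ≈⟨ cycleSet⇔pair p y ⟨
      cycleSet c h (proj₁ p) y      ∎
      where open SetoidReasoning (⇔-setoid 0ℓ)

lemma2p1 : (n h : ℕ) → 1 ≤ h → 2 * h ≤ n → (c : Perm n) → IsCycle (2 * h) c →
    Inverse (CyclesSetoid c h) (DecompSetoid c h)
      × Inverse (setoid (Fin h)) (DecompSetoid c h)
lemma2p1 n zero     ()  _ _ _
lemma2p1 n (suc h′) _ _ c c-cycle = Composition.inverse Cycles↔Fin Fin↔Decomp , Fin↔Decomp
  where open Cycle c c-cycle
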